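{- If $G$ is a finite simple graph with no isolated vertices, then $\Gamma_t(G)\le 2\gamma_{\rm gr}^{\rm Z}(G)$.
   Context: A total dominating set (TD-set) of $G$ is a set $D$ such that every vertex of $G$ has a neighbor in $D$. A TD-set is minimal if no proper subset of it is a TD-set. The upper total domination number $\Gamma_t(G)$ is the maximum cardinality of a minimal TD-set. With $N[v]=N(v)\cup\{v\}$, a sequence $(v_1,\ldots,v_k)$ of distinct vertices is a Z-sequence if for every $i\in\{1,\ldots,k\}$, $N(v_i)\setminus\bigcup_{j<i}N[v_j]\ne\emptyset$; $\gamma_{\rm gr}^{\rm Z}(G)$ is the maximum length of a Z-sequence. -}

module Defs where

open import Data.Nat using (ℕ)
open import Data.Fin using (Fin; toℕ)
open import Data.Fin.Subset using (Subset; _∈_; _∉_; _⊆_; _⊂_)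
open import Data.List using (List; []; _∷_; length; lookup; take)
open import Data.List.Relation.Unary.All using (All)
open import Data.List.Relation.Unary.Unique.Propositional using (Unique)
open import Data.Product using (Σ; ∃; _×_; _,_)
open import Data.Sum using (_⊎_)
open import Relation.Binary.PropositionalEquality using (_≡_)
open import Relation.Nullary using (¬_; Dec)

record Graph (n : ℕ) : Set₁ where
  field
    Adj   : Fin n → Fin n → Set
    adj?  : (u v : Fin n) → Dec (Adj u v)
    sym   : ∀ {u v} → Adj u v → Adj v u
    irrefl : ∀ {v} → ¬ Adj v v

open Graph public

module _ {n : ℕ} (G : Graph n) where

  NoIsolated : Set
  NoIsolated = ∀ v → ∃ λ u → Adj G v u

  IsTDSet : Subset n → Set
  IsTDSet D = ∀ v → ∃ λ u → Adj G v u × u ∈ D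

  IsMinimalTDSet : Subset n → Set
  IsMinimalTDSet D = IsTDSet D × (∀ D′ → D′ ⊂ D → ¬ IsTDSet D′)

  InClosedNbhd : Fin n → Fin n → Set
  InClosedNbhd v w = (w ≡ v) ⊎ Adj G v w

  NotCovered : Fin n → List (Fin n) → Set
  NotCovered w us = All (λ u → ¬ InClosedNbhd u w) us

  ZStep : Fin n → List (Fin n) → Set
  ZStep v earlier = ∃ λ w → Adj G v w × NotCovered w earlier

  IsZSequence : List (Fin n) → Set
  IsZSequence s = Unique s × (∀ (i : Fin (length s)) → ZStep (lookup s i) (take (toℕ i) s))

-- Choose for each v ∈ D a private neighbour π v, a vertex whose only neighbour
-- in D is v; minimality of D provides one.  Call v leading if π v is not an
-- earlier vertex of D.  Listed in increasing order, the leading vertices form a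
-- Z-sequence: for a leading v, no earlier u ∈ D is adjacent to π v (its only
-- D-neighbour is v) or equal to π v.  If v ∈ D is not leading then π v is
-- leading, and π is injective on D, so at most half of D is not leading.

module Submission where

open import Defs
open import Data.Nat using (ℕ; _≤_; _*_)
open import Data.Fin.Subset using (Subset; ∣_∣)
open import Data.List using (List; length)
open import Data.Product using (∃; _×_)

open import Level using (Level; 0ℓ)
open import Function using (id; _∘_)
open import Data.Nat using (suc; _+_; z≤n; s≤s)
import Data.Nat.Properties as ℕ
open import Data.Fin using (Fin; toℕ; _<_; _≟_)
open import Data.Fin.Properties using (_<?_; <-asym; <-irrefl; ≤∧≢⇒<; ¬∀⟶∃¬; any?; suc-injective)
open import Data.Fin.Subset using (_∈_; _∉_; _-_; inside; outside)
open import Data.Fin.Subset.Properties using (_∈?_; x∈p⇒p-x⊂p; x∈p∧x≢y⇒x∈p-y)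
import Data.Vec as Vec
open import Data.List using ([]; _∷_; allFin; filter; lookup; take; map)
open import Data.List.Properties using (filter-notAll; length-map)
open import Data.List.Membership.Propositional using () renaming (_∈_ to _∈ₗ_)
open import Data.List.Membership.Propositional.Properties
  using (∈-filter⁺; ∈-filter⁻; ∈-lookup; ∈-allFin)
open import Data.List.Relation.Unary.All as All using (All; []; _∷_)
open import Data.List.Relation.Unary.All.Properties using (all-filter)
import Data.List.Relation.Unary.All.Properties as All
open import Data.List.Relation.Unary.Any using (here; there)
import Data.List.Relation.Unary.Any as Any
open import Data.List.Relation.Unary.AllPairs using (AllPairs; []; _∷_)
import Data.List.Relation.Unary.AllPairs.Properties as AllPairs
open import Data.List.Relation.Unary.Unique.Propositional using (Unique)
import Data.List.Relation.Unary.Unique.Propositional.Properties as Unique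
open import Data.Product using (Σ; _,_; proj₁; proj₂)
open import Data.Sum using (_⊎_; inj₁; inj₂)
open import Relation.Binary using (Rel; DecidableEquality)
open import Relation.Binary.PropositionalEquality
  using (_≡_; _≢_; refl; trans; cong; subst)
import Relation.Binary.PropositionalEquality as ≡
open import Relation.Nullary using (¬_; yes; no; ¬?; contradiction)
open import Relation.Nullary.Decidable using (decidable-stable; _×-dec_; _⊎-dec_)
open import Relation.Unary using (Pred; Decidable)
open import Relation.Unary.Properties using (∁?)

private
  variable
    a b p r : Level
    A : Set a
    B : Set b

length-filter+filter-∁ : {P : Pred A p} (P? : Decidable P) (xs : List A) →
  length (filter P? xs) + length (filter (∁? P?) xs) ≡ length xs
length-filter+filter-∁ P? [] = refl
length-filter+filter-∁ P? (x ∷ xs) with P? x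
... | yes _ = cong suc (length-filter+filter-∁ P? xs)
... | no _ = trans (ℕ.+-suc _ _) (cong suc (length-filter+filter-∁ P? xs))

injectiveOn⇒length≤ : DecidableEquality B → (f : A → B) → ∀ {xs ys} → Unique xs →
  (∀ {x} → x ∈ₗ xs → f x ∈ₗ ys) →
  (∀ {x y} → x ∈ₗ xs → y ∈ₗ xs → f x ≡ f y → x ≡ y) →
  length xs ≤ length ys
injectiveOn⇒length≤ _≟ᴮ_ f {[]} _ _ _ = z≤n
injectiveOn⇒length≤ _≟ᴮ_ f {x ∷ xs} {ys} (x∉xs ∷ unique) maps injective =
  ℕ.<-≤-trans (s≤s (injectiveOn⇒length≤ _≟ᴮ_ f unique maps′ injective′))
              (filter-notAll ≢fx? ys (Any.map (λ fx≡y y≡fx → y≡fx (≡.sym fx≡y)) (maps (here refl))))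
  where
  ≢fx? : Decidable (_≢ f x)
  ≢fx? y = ¬? (y ≟ᴮ f x)
  maps′ : ∀ {y} → y ∈ₗ xs → f y ∈ₗ filter ≢fx? ys
  maps′ y∈xs = ∈-filter⁺ ≢fx? (maps (there y∈xs))
    λ fy≡fx → All.lookup x∉xs y∈xs (≡.sym (injective (there y∈xs) (here refl) fy≡fx))
  injective′ : ∀ {y z} → y ∈ₗ xs → z ∈ₗ xs → f y ≡ f z → y ≡ z
  injective′ y∈xs z∈xs = injective (there y∈xs) (there z∈xs)

AllPairs⇒All-take-lookup : {R : Rel A r} {xs : List A} → AllPairs R xs →
  (i : Fin (length xs)) → All (λ u → R u (lookup xs i)) (take (toℕ i) xs)
AllPairs⇒All-take-lookup (_ ∷ _) Fin.zero = []
AllPairs⇒All-take-lookup {xs = _ ∷ xs} (Rx ∷ pairs) (Fin.suc i) =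
  All.lookup Rx (∈-lookup {xs = xs} i) ∷ AllPairs⇒All-take-lookup pairs i

AllPairs-restrict : {P : Pred A p} {R S : Rel A r} →
  (∀ {x y} → P x → P y → R x y → S x y) →
  ∀ {xs} → All P xs → AllPairs R xs → AllPairs S xs
AllPairs-restrict R⇒S [] [] = []
AllPairs-restrict R⇒S (Px ∷ Pxs) (Rx ∷ pairs) =
  All.zipWith (λ (Py , Rxy) → R⇒S Px Py Rxy) (Pxs , Rx) ∷ AllPairs-restrict R⇒S Pxs pairs

enumerate : ∀ {n} (D : Subset n) → ∃ λ xs → Unique xs × All (_∈ D) xs × ∣ D ∣ ≡ length xs
enumerate Vec.[] = [] , [] , [] , refl
enumerate (outside Vec.∷ D) with enumerate D
... | xs , unique , ⊆D , ∣D∣≡ =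
  map Fin.suc xs , Unique.map⁺ suc-injective unique ,
  All.map⁺ (All.map Vec.there ⊆D) , trans ∣D∣≡ (≡.sym (length-map Fin.suc xs))
enumerate (inside Vec.∷ D) with enumerate D
... | xs , unique , ⊆D , ∣D∣≡ =
  Fin.zero ∷ map Fin.suc xs ,
  All.map⁺ (All.universal (λ _ ()) xs) ∷ Unique.map⁺ suc-injective unique ,
  Vec.here ∷ All.map⁺ (All.map Vec.there ⊆D) , cong suc (trans ∣D∣≡ (≡.sym (length-map Fin.suc xs)))

choice : ∀ {n : ℕ} {P : Pred (Fin n) p} {R : Fin n → Fin n → Set r} → Decidable P →
  (∀ {v} → P v → ∃ (R v)) → Σ (Fin n → Fin n) λ f → ∀ {v} → P v → R v (f v)
choice {n = n} {P = P} {R} P? choose = f , f-spec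
  where
  f : Fin n → Fin n
  f v with P? v
  ... | yes Pv = proj₁ (choose Pv)
  ... | no _ = v
  f-spec : ∀ {v} → P v → R v (f v)
  f-spec {v} Pv with P? v
  ... | yes Pv′ = proj₂ (choose Pv′)
  ... | no ¬Pv = contradiction Pv ¬Pv

module _ {n : ℕ} (G : Graph n) where

  IsPrivateNeighbour : Subset n → Fin n → Fin n → Set
  IsPrivateNeighbour D v w = Adj G w v × (∀ u → Adj G w u → u ∈ D → u ≡ v)

  -- D - v is not a TD-set; a vertex it fails to dominate is a private neighbour of v.
  minimalTD⇒privateNeighbour : ∀ {D} → IsMinimalTDSet G D →
    ∀ {v} → v ∈ D → ∃ (IsPrivateNeighbour D v)
  minimalTD⇒privateNeighbour {D} (isTD , minimal) {v} v∈D = w , isPrivate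
    where
    undominated : ∃ λ w → ¬ ∃ λ u → Adj G w u × u ∈ D - v
    undominated = ¬∀⟶∃¬ n _ (λ w → any? λ u → adj? G w u ×-dec u ∈? D - v)
                    (minimal (D - v) (x∈p⇒p-x⊂p v∈D))
    w : Fin n
    w = proj₁ undominated
    onlyNeighbour : ∀ u → Adj G w u → u ∈ D → u ≡ v
    onlyNeighbour u w~u u∈D = decidable-stable (u ≟ v) λ u≢v →
      proj₂ undominated (u , w~u , x∈p∧x≢y⇒x∈p-y u∈D u≢v)
    isPrivate : IsPrivateNeighbour D v w
    isPrivate with isTD w
    ... | u , w~u , u∈D = subst (Adj G w) (onlyNeighbour u w~u u∈D) w~u , onlyNeighbour

  witnessed⇒IsZSequence : (w : Fin n → Fin n) → ∀ {s} → Unique s →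
    All (λ x → Adj G x (w x)) s →
    AllPairs (λ u x → ¬ InClosedNbhd G u (w x)) s →
    IsZSequence G s
  witnessed⇒IsZSequence w {s} unique adjacent uncovered = unique , λ i →
    w (lookup s i) , All.lookup adjacent (∈-lookup {xs = s} i) ,
    AllPairs⇒All-take-lookup uncovered i

module PrivateNeighbourOrdering {n : ℕ} (G : Graph n) (D : Subset n) (π : Fin n → Fin n)
  (π-private : ∀ {v} → v ∈ D → IsPrivateNeighbour G D v (π v)) where

  Leading : Pred (Fin n) 0ℓ
  Leading v = v ∈ D × (π v ∉ D ⊎ v < π v)

  leading? : Decidable Leading
  leading? v = v ∈? D ×-dec (¬? (π v ∈? D) ⊎-dec v <? π v)

  adjacent-π : ∀ {v} → v ∈ D → Adj G v (π v)
  adjacent-π v∈D = Graph.sym G (proj₁ (π-private v∈D))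

  onlyNeighbour-π : ∀ {v u} → v ∈ D → Adj G u (π v) → u ∈ D → u ≡ v
  onlyNeighbour-π v∈D u~πv = proj₂ (π-private v∈D) _ (Graph.sym G u~πv)

  π-injectiveOn : ∀ {x y} → x ∈ D → y ∈ D → π x ≡ π y → x ≡ y
  π-injectiveOn x∈D y∈D πx≡πy =
    onlyNeighbour-π y∈D (subst (Adj G _) πx≡πy (adjacent-π x∈D)) x∈D

  π-notCoveredByEarlier : ∀ {u x} → u ∈ D → Leading x → u < x → ¬ InClosedNbhd G u (π x)
  π-notCoveredByEarlier u∈D (_ , inj₁ πx∉D) _ (inj₁ πx≡u) = πx∉D (subst (_∈ D) (≡.sym πx≡u) u∈D)
  π-notCoveredByEarlier _ (_ , inj₂ x<πx) u<x (inj₁ πx≡u) = <-asym u<x (subst (_ <_) πx≡u x<πx)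
  π-notCoveredByEarlier u∈D (x∈D , _) u<x (inj₂ u~πx) = <-irrefl (onlyNeighbour-π x∈D u~πx u∈D) u<x

  -- π (π v) is a neighbour of π v, so it is either outside D or equal to v > π v.
  π-leading : ∀ {v} → v ∈ D → ¬ Leading v → Leading (π v)
  π-leading {v} v∈D ¬leading = πv∈D , πv<ππv
    where
    πv∈D : π v ∈ D
    πv∈D = decidable-stable (π v ∈? D) (λ πv∉D → ¬leading (v∈D , inj₁ πv∉D))
    πv<v : π v < v
    πv<v = ≤∧≢⇒< (ℕ.≮⇒≥ (λ v<πv → ¬leading (v∈D , inj₂ v<πv)))
                 (λ πv≡v → Graph.irrefl G (subst (Adj G v) πv≡v (adjacent-π v∈D)))
    πv<ππv : π (π v) ∉ D ⊎ π v < π (π v)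
    πv<ππv with π (π v) ∈? D
    ... | no ππv∉D = inj₁ ππv∉D
    ... | yes ππv∈D = inj₂ (subst (π v <_)
                  (≡.sym (onlyNeighbour-π v∈D (proj₁ (π-private πv∈D)) ππv∈D)) πv<v)

  leaders : List (Fin n)
  leaders = filter leading? (allFin n)

  ∈-leaders : ∀ {v} → Leading v → v ∈ₗ leaders
  ∈-leaders = ∈-filter⁺ leading? (∈-allFin _)

  leaders-isZSequence : IsZSequence G leaders
  leaders-isZSequence = witnessed⇒IsZSequence G π
    (Unique.filter⁺ leading? (Unique.allFin⁺ n))
    (All.map (adjacent-π ∘ proj₁) (all-filter leading? (allFin n)))
    (AllPairs-restrict (λ lu lx → π-notCoveredByEarlier (proj₁ lu) lx)
      (all-filter leading? (allFin n))
      (AllPairs.filter⁺ leading? (AllPairs.tabulate⁺-< id)))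

  leading-part≤ : ∀ {xs} → Unique xs → length (filter leading? xs) ≤ length leaders
  leading-part≤ {xs} unique = injectiveOn⇒length≤ _≟_ id (Unique.filter⁺ leading? unique)
    (∈-leaders ∘ proj₂ ∘ ∈-filter⁻ leading? {xs = xs}) (λ _ _ → id)

  nonleading-part≤ : ∀ {xs} → Unique xs → All (_∈ D) xs →
    length (filter (∁? leading?) xs) ≤ length leaders
  nonleading-part≤ {xs} unique ⊆D = injectiveOn⇒length≤ _≟_ π (Unique.filter⁺ (∁? leading?) unique)
    (λ x∈ → ∈-leaders (π-leading (∈D x∈) (proj₂ (∈-filter⁻ (∁? leading?) {xs = xs} x∈))))
    (λ x∈ y∈ → π-injectiveOn (∈D x∈) (∈D y∈))
    where
    ∈D : ∀ {x} → x ∈ₗ filter (∁? leading?) xs → x ∈ D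
    ∈D = All.lookup ⊆D ∘ proj₁ ∘ ∈-filter⁻ (∁? leading?) {xs = xs}

  ∣D∣≤2*length-leaders : ∣ D ∣ ≤ 2 * length leaders
  ∣D∣≤2*length-leaders with enumerate D
  ... | xs , unique , ⊆D , ∣D∣≡ = begin
    ∣ D ∣                                                          ≡⟨ ∣D∣≡ ⟩
    length xs                                                      ≡⟨ length-filter+filter-∁ leading? xs ⟨
    length (filter leading? xs) + length (filter (∁? leading?) xs) ≤⟨ ℕ.+-mono-≤ (leading-part≤ unique)
                                                                                  (nonleading-part≤ unique ⊆D) ⟩
    length leaders + length leaders                                ≡⟨ cong (length leaders +_) (ℕ.+-identityʳ _) ⟨
    2 * length leaders                                             ∎
    where open ℕ.≤-Reasoning

-- The hypothesis NoIsolated G is implied by the existence of the TD-set D.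
theorem4p2 : ∀ {n : ℕ} (G : Graph n) → NoIsolated G →
    ∀ (D : Subset n) → IsMinimalTDSet G D →
    ∃ λ (s : List _) → IsZSequence G s × ∣ D ∣ ≤ 2 * length s
theorem4p2 G _ D minimal =
  let (π , π-private) = choice (_∈? D) (minimalTD⇒privateNeighbour G minimal)
      open PrivateNeighbourOrdering G D π π-private
  in leaders , leaders-isZSequence , ∣D∣≤2*length-leaders
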